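{- Let $r_{\max}>0$. If the thresholds satisfy $\sum_{u\in N(v)}\theta(u,v)\le r_{\max}\, d(v)$ for all $v\in V$, then EdgePush with source $s$ returns $\hat{\boldsymbol\pi}=\alpha\mathbf q$ with normalized additive error at most $r_{\max}$ at every node, i.e. $\left|\frac{\boldsymbol\pi_s(t)}{d(t)}-\frac{\hat{\boldsymbol\pi}(t)}{d(t)}\right|\le r_{\max}$ for all $t\in V$.
   Context: $G=(V,E)$ is an undirected graph with symmetric non-negative weighted adjacency matrix $\mathbf A$; $\bar E$ contains both directed edges $\langle u,v\rangle,\langle v,u\rangle$ of each $\{u,v\}\in E$; $N(u)$ is the neighbor set of $u$, $d(u)=\sum_{v\in N(u)}\mathbf A_{uv}>0$, $\mathbf D=\mathrm{diag}(d(u))$, $\mathbf P=\mathbf A\mathbf D^{ -1}$. Fix $\alpha\in(0,1)$. For a node $x$, $\boldsymbol\pi_x=\alpha(\mathbf I-(1-\alpha)\mathbf P)^{ -1}\mathbf e_x$ is the Personalized PageRank vector with source $x$. EdgePush: given thresholds $\theta(u,v)>0$ for $\langle u,v\rangle\in\bar E$, it maintains a node income vector $\mathbf q$ and edge expenses $\mathbf{Q}_{uv}$, initialized $\mathbf q=\mathbf e_s$, $\mathbf Q=\mathbf 0$. The edge residue is $\mathbf R_{uv}=(1-\alpha)\mathbf q(u)\mathbf A_{uv}/d(u)-\mathbf Q_{uv}$. While some $\langle u,v\rangle\in\bar E$ has $\mathbf R_{uv}\ge\theta(u,v)$, it picks an arbitrary such edge, sets $y=\mathbf R_{uv}$ and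 performs an edge-based push $\mathbf Q_{uv}\leftarrow\mathbf Q_{uv}+y$, $\mathbf q(v)\leftarrow\mathbf q(v)+y$. On termination it outputs $\hat{\boldsymbol\pi}=\alpha\mathbf q$.
   Formalization: The edge weights, the parameter $\alpha$, the thresholds $\theta(u,v)$, $r_{\max}$ and the vectors $\boldsymbol\pi_s$ and $\mathbf q$ take rational values rather than real ones. -}

module Defs where

open import Data.Nat using (ℕ; zero; suc)
open import Data.Fin using (Fin; zero; suc)
import Data.Fin as F
open import Data.Rational using (ℚ; 0ℚ; 1ℚ; _+_; _*_; _-_; 1/_; ≢-nonZero; _<_; _≤_)
open import Data.Rational.Properties using (_≟_; _<?_)
open import Relation.Nullary using (yes; no)
open import Relation.Binary.PropositionalEquality using (_≡_)

sumFin : ∀ n → (Fin n → ℚ) → ℚ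
sumFin zero    f = 0ℚ
sumFin (suc n) f = f zero + sumFin n (λ i → f (suc i))

-- multiplicative inverse; only ever applied to quantities proven positive
inv : ℚ → ℚ
inv x with x ≟ 0ℚ
... | yes _ = 0ℚ
... | no x≢0 = 1/_ x {{≢-nonZero x≢0}}

δ : ∀ {n} → Fin n → Fin n → ℚ
δ x u with x F.≟ u
... | yes _ = 1ℚ
... | no _  = 0ℚ

module Graph (n : ℕ) (A : Fin n → Fin n → ℚ) where

  Edge : Fin n → Fin n → Set
  Edge u v = 0ℚ < A u v

  -- d(u) = Σ_{v ∈ N(u)} A_uv  (= Σ_v A_uv since A_uv = 0 off N(u))
  deg : Fin n → ℚ
  deg u = sumFin n (λ v → A u v)

  P : Fin n → Fin n → ℚ
  P u v = A u v * inv (deg v)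

  -- π is the PPR vector with source x and parameter α:
  -- π = α (I - (1-α)P)^{-1} e_x, i.e. (I - (1-α)P) π = α e_x
  IsPPR : ℚ → Fin n → (Fin n → ℚ) → Set
  IsPPR α x π = ∀ u → π u - (1ℚ - α) * sumFin n (λ v → P u v * π v) ≡ α * δ x u

  neighbourSum : (Fin n → Fin n → ℚ) → Fin n → ℚ
  neighbourSum θ v = sumFin n pick
    where
      pick : Fin n → ℚ
      pick u with 0ℚ <? A u v
      ... | yes _ = θ u v
      ... | no _  = 0ℚ

  record State : Set where
    constructor ⟨_,_⟩
    field
      q : Fin n → ℚ
      Q : Fin n → Fin n → ℚ
  open State public

  initState : Fin n → State
  initState s = ⟨ δ s , (λ _ _ → 0ℚ) ⟩

  residue : ℚ → State → Fin n → Fin n → ℚ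
  residue α σ u v = (1ℚ - α) * q σ u * A u v * inv (deg u) - Q σ u v

  push : ℚ → State → Fin n → Fin n → State
  push α σ u v = ⟨ q′ , Q′ ⟩
    where
      y : ℚ
      y = residue α σ u v
      q′ : Fin n → ℚ
      q′ w with v F.≟ w
      ... | yes _ = q σ w + y
      ... | no _  = q σ w
      Q′ : Fin n → Fin n → ℚ
      Q′ a b with u F.≟ a | v F.≟ b
      ... | yes _ | yes _ = Q σ a b + y
      ... | _     | _     = Q σ a b

  -- states reachable by EdgePush from source s (arbitrary choice of eligible edge)
  data Reachable (α : ℚ) (θ : Fin n → Fin n → ℚ) (s : Fin n) : State → Set where
    start : Reachable α θ s (initState s)
    step  : ∀ {σ} u v → Reachable α θ s σ → Edge u v →
            θ u v ≤ residue α σ u v → Reachable α θ s (push α σ u v)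

  Terminal : ℚ → (Fin n → Fin n → ℚ) → State → Set
  Terminal α θ σ = ∀ u v → Edge u v → residue α σ u v < θ u v

{-# OPTIONS --safe #-}
-- EdgePush preserves three invariants: q = e_s + Σ_u Q_{u·}, Q vanishes off edges, and every
-- residue is nonnegative. Writing r(v) = Σ_u R_uv for the residue flowing into v, these and the
-- symmetry of A turn the PPR equation into y(u) d(u) = (1-α) Σ_v A_uv y(v) + α r(u) for the
-- normalised error y = (π_s - α q)/d. At termination 0 ≤ r(v) ≤ Σ_{u ∈ N(v)} θ(u,v) ≤ r_max d(v),
-- and a discrete maximum principle (at a node where y is largest, resp. smallest, the weighted
-- average Σ_v A_uv y(v) / d(u) cannot exceed, resp. undercut, y(u)) gives 0 ≤ y ≤ r_max.
module Submission where

open import Defs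
open import Data.Nat using (ℕ; zero; suc)
open import Data.Fin using (Fin; zero; suc)
import Data.Fin as F
open import Data.List using (allFin)
open import Data.List.Membership.Propositional.Properties using (∈-allFin)
open import Data.List.Relation.Unary.All using (lookup)
open import Data.Product using (∃; _,_)
open import Data.Empty using (⊥-elim)
open import Data.Rational using (ℚ; 0ℚ; 1ℚ; _+_; _*_; _-_; -_; ∣_∣; _≤_; _<_; ≢-nonZero; Positive; positive; nonNegative)
open import Data.Rational.Properties
open import Data.Rational.Solver using (module +-*-Solver)
open import Algebra.Properties.Group +-0-group using (⁻¹-involutive)
open import Relation.Binary.Bundles using (DecTotalOrder)
open import Data.List.Extrema (DecTotalOrder.totalOrder ≤-decTotalOrder) using (argmax; f[xs]≤f[argmax])
open import Relation.Binary.PropositionalEquality using (_≡_; _≢_; ≢-sym; refl; sym; trans; cong; cong₂; subst; subst₂; module ≡-Reasoning)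
open import Relation.Nullary using (yes; no; ¬_)
open import Function using (_∘_)

open +-*-Solver using (solve; _:=_; _:+_; _:*_; _:-_; :-_; con)

sumFin-cong : ∀ n {f g : Fin n → ℚ} → (∀ i → f i ≡ g i) → sumFin n f ≡ sumFin n g
sumFin-cong zero    f≗g = refl
sumFin-cong (suc n) f≗g = cong₂ _+_ (f≗g zero) (sumFin-cong n (f≗g ∘ suc))

sumFin-zero : ∀ n → sumFin n (λ _ → 0ℚ) ≡ 0ℚ
sumFin-zero zero    = refl
sumFin-zero (suc n) = trans (+-identityˡ _) (sumFin-zero n)

sumFin-+ : ∀ n (f g : Fin n → ℚ) → sumFin n (λ i → f i + g i) ≡ sumFin n f + sumFin n g
sumFin-+ zero    f g = refl
sumFin-+ (suc n) f g = trans (cong (f zero + g zero +_) (sumFin-+ n (f ∘ suc) (g ∘ suc)))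
  (solve 4 (λ a b c d → (a :+ b) :+ (c :+ d) := (a :+ c) :+ (b :+ d)) refl
     (f zero) (g zero) (sumFin n (f ∘ suc)) (sumFin n (g ∘ suc)))

sumFin-neg : ∀ n (f : Fin n → ℚ) → sumFin n (λ i → - f i) ≡ - sumFin n f
sumFin-neg zero    f = refl
sumFin-neg (suc n) f = trans (cong (- f zero +_) (sumFin-neg n (f ∘ suc)))
  (sym (neg-distrib-+ (f zero) (sumFin n (f ∘ suc))))

sumFin-*ˡ : ∀ n c (f : Fin n → ℚ) → sumFin n (λ i → c * f i) ≡ c * sumFin n f
sumFin-*ˡ zero    c f = sym (*-zeroʳ c)
sumFin-*ˡ (suc n) c f = trans (cong (c * f zero +_) (sumFin-*ˡ n c (f ∘ suc)))
  (sym (*-distribˡ-+ c (f zero) (sumFin n (f ∘ suc))))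

sumFin-*ʳ : ∀ n c (f : Fin n → ℚ) → sumFin n (λ i → f i * c) ≡ sumFin n f * c
sumFin-*ʳ zero    c f = sym (*-zeroˡ c)
sumFin-*ʳ (suc n) c f = trans (cong (f zero * c +_) (sumFin-*ʳ n c (f ∘ suc)))
  (sym (*-distribʳ-+ c (f zero) (sumFin n (f ∘ suc))))

sumFin-mono : ∀ n {f g : Fin n → ℚ} → (∀ i → f i ≤ g i) → sumFin n f ≤ sumFin n g
sumFin-mono zero    f≤g = ≤-refl
sumFin-mono (suc n) f≤g = +-mono-≤ (f≤g zero) (sumFin-mono n (f≤g ∘ suc))

sumFin-nonNeg : ∀ n {f : Fin n → ℚ} → (∀ i → 0ℚ ≤ f i) → 0ℚ ≤ sumFin n f
sumFin-nonNeg n {f} f≥0 = subst (_≤ sumFin n f) (sumFin-zero n) (sumFin-mono n f≥0)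

δ-suc : ∀ {n} (u i : Fin n) → δ (suc u) (suc i) ≡ δ u i
δ-suc u i with u F.≟ i
... | yes _ = refl
... | no _  = refl

δ-nonNeg : ∀ {n} (u i : Fin n) → 0ℚ ≤ δ u i
δ-nonNeg u i with u F.≟ i
... | yes _ = nonNegative⁻¹ 1ℚ
... | no _  = ≤-refl

sumFin-δ : ∀ n (u : Fin n) (f : Fin n → ℚ) → sumFin n (λ i → δ u i * f i) ≡ f u
sumFin-δ (suc n) zero f = begin
  1ℚ * f zero + sumFin n (λ i → 0ℚ * f (suc i))
    ≡⟨ cong₂ _+_ (*-identityˡ (f zero)) (sumFin-cong n (*-zeroˡ ∘ f ∘ suc)) ⟩
  f zero + sumFin n (λ _ → 0ℚ)
    ≡⟨ cong (f zero +_) (sumFin-zero n) ⟩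
  f zero + 0ℚ
    ≡⟨ +-identityʳ (f zero) ⟩
  f zero
    ∎
  where open ≡-Reasoning
sumFin-δ (suc n) (suc u) f = begin
  0ℚ * f zero + sumFin n (λ i → δ (suc u) (suc i) * f (suc i))
    ≡⟨ cong₂ _+_ (*-zeroˡ (f zero)) (sumFin-cong n λ i → cong (_* f (suc i)) (δ-suc u i)) ⟩
  0ℚ + sumFin n (λ i → δ u i * f (suc i))
    ≡⟨ +-identityˡ (sumFin n (λ i → δ u i * f (suc i))) ⟩
  sumFin n (λ i → δ u i * f (suc i))
    ≡⟨ sumFin-δ n u (f ∘ suc) ⟩
  f (suc u)
    ∎
  where open ≡-Reasoning

*-nonNeg : ∀ {p q} → 0ℚ ≤ p → 0ℚ ≤ q → 0ℚ ≤ p * q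
*-nonNeg {p} {q} p≥0 q≥0 =
  nonNegative⁻¹ (p * q) {{nonNeg*nonNeg⇒nonNeg p {{nonNegative p≥0}} q {{nonNegative q≥0}}}}

p≤q⇒0≤q-p : ∀ {p q} → p ≤ q → 0ℚ ≤ q - p
p≤q⇒0≤q-p {p} {q} p≤q = subst (_≤ q - p) (+-inverseʳ p) (+-monoˡ-≤ (- p) p≤q)

x+0*y≡x : ∀ x y → x + 0ℚ * y ≡ x
x+0*y≡x x y = trans (cong (x +_) (*-zeroˡ y)) (+-identityʳ x)

x-0*y≡x : ∀ x y → x - 0ℚ * y ≡ x
x-0*y≡x x y = trans (cong (λ z → x - z) (*-zeroˡ y)) (+-identityʳ x)

inv-nonNeg : ∀ {p} → 0ℚ ≤ p → 0ℚ ≤ inv p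
inv-nonNeg {p} p≥0 with p ≟ 0ℚ
... | yes _   = ≤-refl
... | no p≢0 = <⇒≤ (positive⁻¹ _ {{1/pos⇒pos p {{p>0}}}})
  where
  p>0 : Positive p
  p>0 = nonNeg∧nonZero⇒pos p {{nonNegative p≥0}} {{≢-nonZero p≢0}}

inv-inverseʳ : ∀ {p} → p ≢ 0ℚ → p * inv p ≡ 1ℚ
inv-inverseʳ {p} p≢0 with p ≟ 0ℚ
... | yes p≡0 = ⊥-elim (p≢0 p≡0)
... | no p≢0′ = *-inverseʳ p {{≢-nonZero p≢0′}}

maximum-attained : ∀ {n} → Fin n → (f : Fin n → ℚ) → ∃ λ m → ∀ i → f i ≤ f m
maximum-attained {n} i₀ f =
  argmax f i₀ (allFin n) , λ i → lookup (f[xs]≤f[argmax] i₀ (allFin n)) (∈-allFin i)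

x≤[1-α]x+αz⇒αx≤αz : ∀ α x z → x ≤ (1ℚ - α) * x + α * z → α * x ≤ α * z
x≤[1-α]x+αz⇒αx≤αz α x z x≤ = subst₂ _≤_
  (solve 2 (λ α x → x :- (con 1ℚ :- α) :* x := α :* x) refl α x)
  (solve 3 (λ α x z → (con 1ℚ :- α) :* x :+ α :* z :- (con 1ℚ :- α) :* x := α :* z) refl α x z)
  (+-monoˡ-≤ (- ((1ℚ - α) * x)) x≤)

Balanced : ∀ {n} → (Fin n → Fin n → ℚ) → ℚ → (y r : Fin n → ℚ) → Set
Balanced {n} w α y r =
  ∀ u → y u * sumFin n (w u) ≡ (1ℚ - α) * sumFin n (λ v → w u v * y v) + α * r u

module MaximumPrinciple {n : ℕ} (w : Fin n → Fin n → ℚ) (w-nonNeg : ∀ u v → 0ℚ ≤ w u v)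
  (d-pos : ∀ u → 0ℚ < sumFin n (w u)) (α : ℚ) (α>0 : 0ℚ < α) (α≤1 : α ≤ 1ℚ) where

  private
    d : Fin n → ℚ
    d u = sumFin n (w u)

  max-principle : ∀ {y r} c → Balanced w α y r → (∀ u → r u ≤ c * d u) → ∀ u → y u ≤ c
  max-principle {y} {r} c balanced r≤cd u with maximum-attained u y
  ... | m , y≤y[m] = ≤-trans (y≤y[m] u) y[m]≤c
    where
    open ≤-Reasoning

    averaged : sumFin n (λ v → w m v * y v) ≤ y m * d m
    averaged = begin
      sumFin n (λ v → w m v * y v)
        ≤⟨ sumFin-mono n (λ v → *-monoˡ-≤-nonNeg (w m v) {{nonNegative (w-nonNeg m v)}} (y≤y[m] v)) ⟩
      sumFin n (λ v → w m v * y m)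
        ≡⟨ sumFin-*ʳ n (y m) (w m) ⟩
      d m * y m
        ≡⟨ *-comm (d m) (y m) ⟩
      y m * d m
        ∎

    y[m]d[m]≤ : y m * d m ≤ (1ℚ - α) * (y m * d m) + α * (c * d m)
    y[m]d[m]≤ = begin
      y m * d m
        ≡⟨ balanced m ⟩
      (1ℚ - α) * sumFin n (λ v → w m v * y v) + α * r m
        ≤⟨ +-mono-≤ (*-monoˡ-≤-nonNeg (1ℚ - α) {{nonNegative (p≤q⇒0≤q-p α≤1)}} averaged)
                    (*-monoˡ-≤-nonNeg α {{nonNegative (<⇒≤ α>0)}} (r≤cd m)) ⟩
      (1ℚ - α) * (y m * d m) + α * (c * d m)
        ∎

    y[m]≤c : y m ≤ c
    y[m]≤c = *-cancelʳ-≤-pos (d m) {{positive (d-pos m)}}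
      (*-cancelˡ-≤-pos α {{positive α>0}} (x≤[1-α]x+αz⇒αx≤αz α (y m * d m) (c * d m) y[m]d[m]≤))

  balanced-neg : ∀ {y r} → Balanced w α y r → Balanced w α (-_ ∘ y) (-_ ∘ r)
  balanced-neg {y} {r} balanced u = begin
    - y u * d u
      ≡⟨ sym (neg-distribˡ-* (y u) (d u)) ⟩
    - (y u * d u)
      ≡⟨ cong -_ (balanced u) ⟩
    - ((1ℚ - α) * S + α * r u)
      ≡⟨ solve 4 (λ β S α r → :- (β :* S :+ α :* r) := β :* (:- S) :+ α :* (:- r)) refl (1ℚ - α) S α (r u) ⟩
    (1ℚ - α) * - S + α * - r u
      ≡⟨ cong (λ z → (1ℚ - α) * z + α * - r u) (sym sum-neg) ⟩
    (1ℚ - α) * sumFin n (λ v → w u v * - y v) + α * - r u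
      ∎
    where
    open ≡-Reasoning
    S : ℚ
    S = sumFin n (λ v → w u v * y v)
    sum-neg : sumFin n (λ v → w u v * - y v) ≡ - S
    sum-neg = trans (sumFin-cong n (λ v → sym (neg-distribʳ-* (w u v) (y v))))
                    (sumFin-neg n (λ v → w u v * y v))

  min-principle : ∀ {y r} → Balanced w α y r → (∀ u → 0ℚ ≤ r u) → ∀ u → 0ℚ ≤ y u
  min-principle {y} {r} balanced r≥0 u = subst (0ℚ ≤_) (⁻¹-involutive (y u))
    (neg-antimono-≤ (max-principle 0ℚ (balanced-neg balanced) -r≤0 u))
    where
    -r≤0 : ∀ v → - r v ≤ 0ℚ * d v
    -r≤0 v = subst (- r v ≤_) (sym (*-zeroˡ (d v))) (neg-antimono-≤ (r≥0 v))

module EdgePush {n : ℕ} (A : Fin n → Fin n → ℚ) (α : ℚ) where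
  open Graph n A

  q-push : ∀ σ u v w → q (push α σ u v) w ≡ q σ w + δ v w * residue α σ u v
  q-push σ u v w with v F.≟ w
  ... | yes _ = cong (q σ w +_) (sym (*-identityˡ (residue α σ u v)))
  ... | no _  = sym (x+0*y≡x (q σ w) (residue α σ u v))

  Q-push : ∀ σ u v a b → Q (push α σ u v) a b ≡ Q σ a b + δ u a * δ v b * residue α σ u v
  Q-push σ u v a b with u F.≟ a | v F.≟ b
  ... | yes _ | yes _ = cong (Q σ a b +_) (sym (*-identityˡ (residue α σ u v)))
  ... | yes _ | no _  = sym (x+0*y≡x (Q σ a b) (residue α σ u v))
  ... | no _  | yes _ = sym (x+0*y≡x (Q σ a b) (residue α σ u v))
  ... | no _  | no _  = sym (x+0*y≡x (Q σ a b) (residue α σ u v))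

  sumFin-Q-push : ∀ σ u v w →
    sumFin n (λ a → Q (push α σ u v) a w) ≡ sumFin n (λ a → Q σ a w) + δ v w * residue α σ u v
  sumFin-Q-push σ u v w = begin
    sumFin n (λ a → Q (push α σ u v) a w)
      ≡⟨ sumFin-cong n (λ a → trans (Q-push σ u v a w) (cong (Q σ a w +_) (*-assoc (δ u a) (δ v w) y))) ⟩
    sumFin n (λ a → Q σ a w + δ u a * (δ v w * y))
      ≡⟨ sumFin-+ n (λ a → Q σ a w) (λ a → δ u a * (δ v w * y)) ⟩
    sumFin n (λ a → Q σ a w) + sumFin n (λ a → δ u a * (δ v w * y))
      ≡⟨ cong (sumFin n (λ a → Q σ a w) +_) (sumFin-δ n u (λ _ → δ v w * y)) ⟩
    sumFin n (λ a → Q σ a w) + δ v w * y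
      ∎
    where
    open ≡-Reasoning
    y : ℚ
    y = residue α σ u v

  residue-push : ∀ σ u v a b → residue α (push α σ u v) a b ≡
    (residue α σ a b - δ u a * δ v b * residue α σ u v)
      + (1ℚ - α) * (δ v a * residue α σ u v) * A a b * inv (deg a)
  residue-push σ u v a b = begin
    (1ℚ - α) * q (push α σ u v) a * A a b * inv (deg a) - Q (push α σ u v) a b
      ≡⟨ cong₂ (λ x z → (1ℚ - α) * x * A a b * inv (deg a) - z) (q-push σ u v a) (Q-push σ u v a b) ⟩
    (1ℚ - α) * (q σ a + δ v a * y) * A a b * inv (deg a) - (Q σ a b + δ u a * δ v b * y)
      ≡⟨ solve 7 (λ β x D B ι Z E → β :* (x :+ D) :* B :* ι :- (Z :+ E)
                                   := (β :* x :* B :* ι :- Z :- E) :+ β :* D :* B :* ι)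
                 refl (1ℚ - α) (q σ a) (δ v a * y) (A a b) (inv (deg a)) (Q σ a b) (δ u a * δ v b * y) ⟩
    (residue α σ a b - δ u a * δ v b * y) + (1ℚ - α) * (δ v a * y) * A a b * inv (deg a)
      ∎
    where
    open ≡-Reasoning
    y : ℚ
    y = residue α σ u v

module Invariance {n : ℕ} (A : Fin n → Fin n → ℚ) (A-nonNeg : ∀ u v → 0ℚ ≤ A u v)
  (α : ℚ) (α≤1 : α ≤ 1ℚ) (θ : Fin n → Fin n → ℚ) (θ-pos : ∀ u v → Graph.Edge n A u v → 0ℚ < θ u v)
  (s : Fin n) where
  open Graph n A
  open EdgePush A α

  record Invariant (σ : State) : Set where
    field
      income           : ∀ v → q σ v ≡ δ s v + sumFin n (λ u → Q σ u v)
      expense-off-edge : ∀ u v → ¬ Edge u v → Q σ u v ≡ 0ℚ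
      residue-nonNeg   : ∀ u v → 0ℚ ≤ residue α σ u v

  transfer-nonNeg : ∀ {x} a b → 0ℚ ≤ x → 0ℚ ≤ (1ℚ - α) * x * A a b * inv (deg a)
  transfer-nonNeg a b x≥0 =
    *-nonNeg (*-nonNeg (*-nonNeg (p≤q⇒0≤q-p α≤1) x≥0) (A-nonNeg a b))
             (inv-nonNeg (sumFin-nonNeg n (A-nonNeg a)))

  invariant-init : Invariant (initState s)
  invariant-init = record
    { income           = λ v → sym (trans (cong (δ s v +_) (sumFin-zero n)) (+-identityʳ (δ s v)))
    ; expense-off-edge = λ _ _ _ → refl
    ; residue-nonNeg   = λ a b → subst (0ℚ ≤_) (sym (+-identityʳ _)) (transfer-nonNeg a b (δ-nonNeg s a))
    }

  invariant-push : ∀ {σ} u v → Invariant σ → Edge u v → θ u v ≤ residue α σ u v →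
                   Invariant (push α σ u v)
  invariant-push {σ} u v I e θ≤y = record
    { income           = income′
    ; expense-off-edge = expense-off-edge′
    ; residue-nonNeg   = residue-nonNeg′
    }
    where
    open Invariant I
    y : ℚ
    y = residue α σ u v

    income′ : ∀ w → q (push α σ u v) w ≡ δ s w + sumFin n (λ a → Q (push α σ u v) a w)
    income′ w = begin
      q (push α σ u v) w                              ≡⟨ q-push σ u v w ⟩
      q σ w + δ v w * y                               ≡⟨ cong (_+ δ v w * y) (income w) ⟩
      δ s w + sumFin n (λ a → Q σ a w) + δ v w * y    ≡⟨ +-assoc (δ s w) _ (δ v w * y) ⟩
      δ s w + (sumFin n (λ a → Q σ a w) + δ v w * y)  ≡⟨ cong (δ s w +_) (sym (sumFin-Q-push σ u v w)) ⟩
      δ s w + sumFin n (λ a → Q (push α σ u v) a w)   ∎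
      where open ≡-Reasoning

    expense-off-edge′ : ∀ a b → ¬ Edge a b → Q (push α σ u v) a b ≡ 0ℚ
    expense-off-edge′ a b ¬e with u F.≟ a | v F.≟ b
    ... | yes refl | yes refl = ⊥-elim (¬e e)
    ... | yes _    | no _     = expense-off-edge a b ¬e
    ... | no _     | _        = expense-off-edge a b ¬e

    drained-nonNeg : ∀ a b → 0ℚ ≤ residue α σ a b - δ u a * δ v b * y
    drained-nonNeg a b with u F.≟ a | v F.≟ b
    ... | yes refl | yes refl = ≤-reflexive (sym (trans (cong (λ z → y - z) (*-identityˡ y)) (+-inverseʳ y)))
    ... | yes _    | no _     = subst (0ℚ ≤_) (sym (x-0*y≡x _ y)) (residue-nonNeg a b)
    ... | no _     | yes _    = subst (0ℚ ≤_) (sym (x-0*y≡x _ y)) (residue-nonNeg a b)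
    ... | no _     | no _     = subst (0ℚ ≤_) (sym (x-0*y≡x _ y)) (residue-nonNeg a b)

    residue-nonNeg′ : ∀ a b → 0ℚ ≤ residue α (push α σ u v) a b
    residue-nonNeg′ a b = subst (0ℚ ≤_) (sym (residue-push σ u v a b))
      (+-mono-≤ (drained-nonNeg a b) (transfer-nonNeg a b (*-nonNeg (δ-nonNeg v a) y≥0)))
      where
      y≥0 : 0ℚ ≤ y
      y≥0 = ≤-trans (<⇒≤ (θ-pos u v e)) θ≤y

  reachable⇒invariant : ∀ {σ} → Reachable α θ s σ → Invariant σ
  reachable⇒invariant start                  = invariant-init
  reachable⇒invariant (step u v reach e θ≤y) = invariant-push u v (reachable⇒invariant reach) e θ≤y

  module Terminated (A-sym : ∀ u v → A u v ≡ A v u) (deg-pos : ∀ u → 0ℚ < deg u)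
    (σ : State) (I : Invariant σ) (T : Terminal α θ σ) where
    open Invariant I

    inflow : Fin n → ℚ
    inflow v = sumFin n (λ u → residue α σ u v)

    inflow-nonNeg : ∀ v → 0ℚ ≤ inflow v
    inflow-nonNeg v = sumFin-nonNeg n (λ u → residue-nonNeg u v)

    residue-off-edge : ∀ u v → ¬ Edge u v → residue α σ u v ≡ 0ℚ
    residue-off-edge u v ¬e = begin
      (1ℚ - α) * q σ u * A u v * inv (deg u) - Q σ u v
        ≡⟨ cong₂ (λ a z → (1ℚ - α) * q σ u * a * inv (deg u) - z) A≡0 (expense-off-edge u v ¬e) ⟩
      (1ℚ - α) * q σ u * 0ℚ * inv (deg u) - 0ℚ
        ≡⟨ solve 3 (λ β x ι → β :* x :* con 0ℚ :* ι :- con 0ℚ := con 0ℚ) refl (1ℚ - α) (q σ u) (inv (deg u)) ⟩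
      0ℚ
        ∎
      where
      open ≡-Reasoning
      A≡0 : A u v ≡ 0ℚ
      A≡0 = ≤-antisym (≮⇒≥ ¬e) (A-nonNeg u v)

    -- neighbourSum sums a where-bound function of Defs that cannot be named here, so the
    -- right-hand side of the pointwise bound is left to unification with its use above.
    mutual
      inflow≤neighbourSum : ∀ v → inflow v ≤ neighbourSum θ v
      inflow≤neighbourSum v = sumFin-mono n (residue≤θ-on-edges v)

      residue≤θ-on-edges : ∀ v u → residue α σ u v ≤ _
      residue≤θ-on-edges v u with 0ℚ <? A u v
      ... | yes e  = <⇒≤ (T u v e)
      ... | no ¬e = ≤-reflexive (residue-off-edge u v ¬e)

    income-balance : ∀ u → q σ u ≡ δ s u + ((1ℚ - α) * sumFin n (λ w → P u w * q σ w) - inflow u)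
    income-balance u = trans (income u) (cong (δ s u +_) expenses)
      where
      expense≡ : ∀ w → Q σ w u ≡ (1ℚ - α) * (P u w * q σ w) - residue α σ w u
      expense≡ w = trans
        (solve 5 (λ β x B ι Z → Z := β :* (B :* ι :* x) :- (β :* x :* B :* ι :- Z)) refl
               (1ℚ - α) (q σ w) (A w u) (inv (deg w)) (Q σ w u))
        (cong (λ z → (1ℚ - α) * (z * inv (deg w) * q σ w) - residue α σ w u) (A-sym w u))

      expenses : sumFin n (λ w → Q σ w u) ≡ (1ℚ - α) * sumFin n (λ w → P u w * q σ w) - inflow u
      expenses = trans (sumFin-cong n expense≡) (trans
        (sumFin-+ n (λ w → (1ℚ - α) * (P u w * q σ w)) (λ w → - residue α σ w u))
        (cong₂ _+_ (sumFin-*ˡ n (1ℚ - α) (λ w → P u w * q σ w)) (sumFin-neg n (λ w → residue α σ w u))))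

    π-balance : ∀ π → IsPPR α s π → ∀ u → π u ≡ α * δ s u + (1ℚ - α) * sumFin n (λ v → P u v * π v)
    π-balance π π-ppr u = trans
      (solve 2 (λ p S → p := (p :- S) :+ S) refl (π u) ((1ℚ - α) * Sπ))
      (cong (_+ (1ℚ - α) * Sπ) (π-ppr u))
      where
      Sπ : ℚ
      Sπ = sumFin n (λ v → P u v * π v)

    normalisedError : (Fin n → ℚ) → Fin n → ℚ
    normalisedError π u = π u * inv (deg u) - α * q σ u * inv (deg u)

    normalisedError-*-deg : ∀ π u → normalisedError π u * deg u ≡ π u - α * q σ u
    normalisedError-*-deg π u = begin
      normalisedError π u * deg u
        ≡⟨ solve 5 (λ p a x ι d → (p :* ι :- a :* x :* ι) :* d := (p :- a :* x) :* (d :* ι))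
                   refl (π u) α (q σ u) (inv (deg u)) (deg u) ⟩
      (π u - α * q σ u) * (deg u * inv (deg u))
        ≡⟨ cong ((π u - α * q σ u) *_) (inv-inverseʳ (≢-sym (<⇒≢ (deg-pos u)))) ⟩
      (π u - α * q σ u) * 1ℚ
        ≡⟨ *-identityʳ (π u - α * q σ u) ⟩
      π u - α * q σ u
        ∎
      where open ≡-Reasoning

    sumFin-A-normalisedError : ∀ π u → sumFin n (λ v → A u v * normalisedError π v)
      ≡ sumFin n (λ v → P u v * π v) - α * sumFin n (λ v → P u v * q σ v)
    sumFin-A-normalisedError π u = trans (sumFin-cong n pointwise) (trans
      (sumFin-+ n (λ v → P u v * π v) (λ v → - (α * (P u v * q σ v))))
      (cong (sumFin n (λ v → P u v * π v) +_)
            (trans (sumFin-neg n (λ v → α * (P u v * q σ v))) (cong -_ (sumFin-*ˡ n α (λ v → P u v * q σ v))))))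
      where
      pointwise : ∀ v → A u v * normalisedError π v ≡ P u v * π v - α * (P u v * q σ v)
      pointwise v = solve 5 (λ B p a x ι → B :* (p :* ι :- a :* x :* ι) := B :* ι :* p :- a :* (B :* ι :* x))
                            refl (A u v) (π v) α (q σ v) (inv (deg v))

    normalisedError-balanced : ∀ π → IsPPR α s π → Balanced A α (normalisedError π) inflow
    normalisedError-balanced π π-ppr u = begin
      normalisedError π u * deg u
        ≡⟨ normalisedError-*-deg π u ⟩
      π u - α * q σ u
        ≡⟨ cong₂ (λ a b → a - α * b) (π-balance π π-ppr u) (income-balance u) ⟩
      α * δ s u + (1ℚ - α) * Sπ - α * (δ s u + ((1ℚ - α) * Sq - inflow u))
        ≡⟨ solve 6 (λ a δ β P Q r → a :* δ :+ β :* P :- a :* (δ :+ (β :* Q :- r)) := β :* (P :- a :* Q) :+ a :* r)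
                   refl α (δ s u) (1ℚ - α) Sπ Sq (inflow u) ⟩
      (1ℚ - α) * (Sπ - α * Sq) + α * inflow u
        ≡⟨ cong (λ z → (1ℚ - α) * z + α * inflow u) (sym (sumFin-A-normalisedError π u)) ⟩
      (1ℚ - α) * sumFin n (λ v → A u v * normalisedError π v) + α * inflow u
        ∎
      where
      open ≡-Reasoning
      Sπ Sq : ℚ
      Sπ = sumFin n (λ v → P u v * π v)
      Sq = sumFin n (λ v → P u v * q σ v)

lemmaA2 : (n : ℕ) (A : Fin n → Fin n → ℚ) →
    (∀ u v → A u v ≡ A v u) →
    (∀ u v → 0ℚ ≤ A u v) →
    (∀ u → 0ℚ < Graph.deg n A u) →
    (α : ℚ) → 0ℚ < α → α < 1ℚ →
    (θ : Fin n → Fin n → ℚ) → (∀ u v → Graph.Edge n A u v → 0ℚ < θ u v) →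
    (rmax : ℚ) → 0ℚ < rmax →
    (∀ v → Graph.neighbourSum n A θ v ≤ rmax * Graph.deg n A v) →
    (s : Fin n) (π : Fin n → ℚ) → Graph.IsPPR n A α s π →
    (σ : Graph.State n A) → Graph.Reachable n A α θ s σ → Graph.Terminal n A α θ σ →
    ∀ t → ∣ π t * inv (Graph.deg n A t) - α * Graph.State.q σ t * inv (Graph.deg n A t) ∣ ≤ rmax
lemmaA2 n A A-sym A-nonNeg deg-pos α α>0 α<1 θ θ-pos rmax _ θ-budget s π π-ppr σ reach terminal t =
  begin
    ∣ normalisedError π t ∣ ≡⟨ 0≤p⇒∣p∣≡p (min-principle balanced inflow-nonNeg t) ⟩
    normalisedError π t     ≤⟨ max-principle rmax balanced inflow≤rmax*deg t ⟩
    rmax                    ∎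
  where
  open ≤-Reasoning
  open Invariance A A-nonNeg α (<⇒≤ α<1) θ θ-pos s
  open Terminated A-sym deg-pos σ (reachable⇒invariant reach) terminal
  open MaximumPrinciple A A-nonNeg deg-pos α α>0 (<⇒≤ α<1)

  balanced : Balanced A α (normalisedError π) inflow
  balanced = normalisedError-balanced π π-ppr

  inflow≤rmax*deg : ∀ v → inflow v ≤ rmax * Graph.deg n A v
  inflow≤rmax*deg v = ≤-trans (inflow≤neighbourSum v) (θ-budget v)
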